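{- If $p$ is a primitive Cayley permutation, then, as (virtual) $\mathbb{L}$-species, \[ \mathrm{Cay}(p) = 1 + \int \bigl(E\cdot \mathrm{Prim}(p)'\bigr) \quad\text{and}\quad \mathrm{Prim}(p) = \int\bigl(E^{ -1}\cdot \mathrm{Cay}(p)'\bigr). \]
   Context: A Cayley permutation of length $n$ is a word $w=w_1\cdots w_n$ of positive integers with $\{w_1,\dots,w_n\}=[k]$ for some $k\le n$; it is primitive if $n\ge1$ and $w_i\ne w_{i+1}$ for $1\le i\le n-1$. A word $w$ contains $p=p_1\cdots p_k$ if some subsequence $w_{i_1}\cdots w_{i_k}$, $i_1<\cdots<i_k$, is order isomorphic to $p$ (same relative order and same equalities); otherwise it avoids $p$. An $\mathbb{L}$-species assigns to each finite totally ordered set a finite set of structures, functorially in order-preserving bijections; $\mathbb{L}$-species and virtual $\mathbb{L}$-species are determined up to isomorphism by the numbers $|F[n]|$ (equivalently by exponential generating series). $\mathrm{Cay}(p)$, $\mathrm{Prim}(p)$: $\mathbb{L}$-species of $p$-avoiding Cayley permutations and of $p$-avoiding primitive Cayley permutations. $1$: one structure on the empty set only; $E$: one structure on every set; $E^{ -1}=\sum_{k\ge0}(-1)^kE_+^k$ is its multiplicative inverse as a virtual species ($E_+$ = $E$ restricted to nonempty sets). Product $(F\cdot G)[\ell]=\bigsqcup_{\ell=\ell_1\sqcup\ell_2}F[\ell_1]\times G[\ell_2]$; derivative $F'[\ell]=F[1\oplus\ell]$ ($\ell$ with a new minimum adjoined); integral $(\int F)[\emptyset]=\emptyset$, $(\int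 F)[\ell]=F[\ell\setminus\{\min\ell\}]$ for $\ell\ne\emptyset$. -}

module Defs where

open import Data.Nat as ℕ using (ℕ; zero; suc; _∸_; _⊔_)
open import Data.Nat.Combinatorics using (_C_)
open import Data.Integer using (ℤ; +_; -_) renaming (_+_ to _+ℤ_; _*_ to _*ℤ_)
open import Data.Bool using (Bool; true; false; _∧_; not; if_then_else_)
open import Data.List using (List; []; _∷_; map; concatMap; _++_; length; zip; upTo; foldr)
open import Data.Bool.ListAction using (all; any)
open import Relation.Binary.PropositionalEquality using (_≡_)
open import Data.Product using (_×_; _,_)

allWords : ℕ → ℕ → List (List ℕ)
allWords m zero    = [] ∷ []
allWords m (suc n) = concatMap (λ a → map (a ∷_) (allWords m n)) (map suc (upTo m))

maxL : List ℕ → ℕ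
maxL = foldr _⊔_ 0

elemᵇ : ℕ → List ℕ → Bool
elemᵇ v = any (λ x → x ℕ.≡ᵇ v)

isCayley : List ℕ → Bool
isCayley w = all (λ x → 1 ℕ.≤ᵇ x) w ∧ all (λ v → elemᵇ v w) (map suc (upTo (maxL w)))

noAdjEq : List ℕ → Bool
noAdjEq []           = true
noAdjEq (x ∷ [])     = true
noAdjEq (x ∷ y ∷ ws) = not (x ℕ.≡ᵇ y) ∧ noAdjEq (y ∷ ws)

nonEmpty : List ℕ → Bool
nonEmpty []      = false
nonEmpty (_ ∷ _) = true

isPrimitive : List ℕ → Bool
isPrimitive w = isCayley w ∧ nonEmpty w ∧ noAdjEq w

subseqs : List ℕ → List (List ℕ)
subseqs []       = [] ∷ []
subseqs (x ∷ xs) = subseqs xs ++ map (x ∷_) (subseqs xs)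

_==_ : Bool → Bool → Bool
true  == b = b
false == b = not b

orderIso : List ℕ → List ℕ → Bool
orderIso u v = (length u ℕ.≡ᵇ length v) ∧
  all (λ { (a , b) → all (λ { (c , d) →
        ((a ℕ.<ᵇ c) == (b ℕ.<ᵇ d)) ∧ ((a ℕ.≡ᵇ c) == (b ℕ.≡ᵇ d)) }) zs }) zs
  where zs = zip u v

contains : List ℕ → List ℕ → Bool
contains w p = any (λ s → orderIso s p) (subseqs w)

countB : {A : Set} → (A → Bool) → List A → ℕ
countB f = foldr (λ x k → if f x then suc k else k) 0

-- (Virtual) L-species, represented by their counting sequences n ↦ |F[n]|

VSpecies : Set
VSpecies = ℕ → ℤ

_≈_ : VSpecies → VSpecies → Set
F ≈ G = ∀ n → F n ≡ G n

infix 4 _≈_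

Cay : List ℕ → VSpecies
Cay p n = + countB (λ w → isCayley w ∧ not (contains w p)) (allWords n n)

Prim : List ℕ → VSpecies
Prim p n = + countB (λ w → isPrimitive w ∧ not (contains w p)) (allWords n n)

sumTo : ℕ → (ℕ → ℤ) → ℤ
sumTo zero    f = f 0
sumTo (suc n) f = sumTo n f +ℤ f (suc n)

𝟙 : VSpecies
𝟙 zero    = + 1
𝟙 (suc _) = + 0

E : VSpecies
E _ = + 1

E₊ : VSpecies
E₊ zero    = + 0
E₊ (suc _) = + 1

_⊕_ : VSpecies → VSpecies → VSpecies
(F ⊕ G) n = F n +ℤ G n

-- product: (F·G)[ℓ] = ⨆_{ℓ = ℓ₁ ⊔ ℓ₂} F[ℓ₁] × G[ℓ₂]
_⊙_ : VSpecies → VSpecies → VSpecies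
(F ⊙ G) n = sumTo n (λ k → (+ (n C k)) *ℤ (F k *ℤ G (n ∸ k)))

infixl 7 _⊙_
infixl 6 _⊕_

-- derivative F'[ℓ] = F[1 ⊕ ℓ]
D : VSpecies → VSpecies
D F n = F (suc n)

∫ : VSpecies → VSpecies
∫ F zero    = + 0
∫ F (suc n) = F n

_^_ : VSpecies → ℕ → VSpecies
F ^ zero  = 𝟙
F ^ suc k = F ⊙ (F ^ k)

sign : ℕ → ℤ
sign zero    = + 1
sign (suc k) = - sign k

-- E⁻¹ = Σ_{k≥0} (-1)^k E₊^k ; on sets of size n only k ≤ n contribute
-- (E₊^k[n] is empty for k > n), so the sum is truncated at k = n.
E⁻¹ : VSpecies
E⁻¹ n = sumTo n (λ k → sign k *ℤ (E₊ ^ k) n)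

-- A primitive pattern has no two equal adjacent letters, so a word avoids it exactly when the
-- word obtained by collapsing every run of equal letters to a single letter does; collapsing
-- also preserves being a Cayley permutation. Hence a p-avoiding Cayley permutation of length
-- n + 1 is a p-avoiding primitive one of length k + 1 whose k + 1 runs are given positive
-- lengths summing to n + 1, in (n choose k) ways: Cay(p)[n + 1] = (E · Prim(p)′)[n], the first
-- identity. The second follows by cancelling E, which E⁻¹ does because (E⁻¹)′ = −E⁻¹ and the
-- product obeys the Leibniz rule.

module Submission where

open import Defs
open import Data.Bool.Base using (Bool; true; false; T; _∧_; _∨_; not; if_then_else_)
open import Data.Bool.Properties using (T-∧; T-≡; ⇔→≡; ∧-assoc; ∧-comm; ∧-zeroʳ; ∧-identityʳ; ∧-conicalˡ; ∧-conicalʳ)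
open import Data.Bool.ListAction using (all; any; and; or)
open import Data.Fin.Base using (Fin; toℕ; inject₁; fromℕ)
import Data.Fin.Properties as Fin
open import Data.Integer.Base using (ℤ; +_; -_; _+_; _-_; _*_)
import Data.Integer.Properties as ℤ
open import Algebra.Properties.Semiring.Sum ℤ.+-*-semiring
  using (sum-syntax; sum-cong-≗; sum-replicate-zero; sum-init-last; ∑-distrib-+)
open import Data.Integer.Tactic.RingSolver using (solve-∀)
open import Data.List.Base using (List; []; _∷_; _++_; map; foldr; concatMap; length; upTo; applyUpTo; zip; lookup)
open import Data.List.Properties using (map-++; map-cong; foldr-map)
open import Data.List.Membership.Propositional using (_∈_; find; lose)
open import Data.List.Membership.Propositional.Properties using (∈-++⁺ˡ; ∈-++⁺ʳ; ∈-++⁻; ∈-map⁺; ∈-map⁻; ∈-upTo⁺)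
open import Data.List.Relation.Binary.Sublist.Propositional using (_⊆_; []; _∷_; _∷ʳ_; ⊆-refl; ⊆-trans)
open import Data.List.Relation.Binary.Sublist.Propositional.Properties using (++⁺)
open import Data.List.Relation.Unary.All as All using (All; []; _∷_)
open import Data.List.Relation.Unary.All.Properties using (all⁺)
open import Data.List.Relation.Unary.Any as Any using (here; there)
open import Data.List.Relation.Unary.Any.Properties using (any⁺; any⁻; lookup-index)
open import Data.Nat.Base as ℕ using (ℕ; zero; suc; _∸_; _≤_; _<_; _≤′_; ≤′-refl; ≤′-step; z≤n; s≤s; _≡ᵇ_; _⊔_)
import Data.Nat.Properties as ℕ
open import Data.Nat.Combinatorics using (_C_; k>n⇒nCk≡0; nCk+nC[k+1]≡[n+1]C[k+1])
open import Data.Product.Base using (∃; ∃₂; ∃-syntax; _×_; _,_; proj₁; proj₂)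
open import Data.Sum.Base as Sum using (_⊎_; inj₁; inj₂)
open import Function.Base using (_∘_)
open import Function.Bundles using (Equivalence; mk⇔)
open import Relation.Binary.PropositionalEquality
open import Relation.Nullary.Negation using (contradiction)
open ≡-Reasoning

-- Finite sums and the product of species

sumTo-cong : ∀ n {f g : ℕ → ℤ} → (∀ k → k ≤ n → f k ≡ g k) → sumTo n f ≡ sumTo n g
sumTo-cong zero    f≗g = f≗g 0 z≤n
sumTo-cong (suc n) f≗g =
  cong₂ _+_ (sumTo-cong n (λ k k≤n → f≗g k (ℕ.m≤n⇒m≤1+n k≤n))) (f≗g (suc n) ℕ.≤-refl)

sumTo-zero : ∀ n {f : ℕ → ℤ} → (∀ k → k ≤ n → f k ≡ + 0) → sumTo n f ≡ + 0
sumTo-zero zero    f≗0 = f≗0 0 z≤n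
sumTo-zero (suc n) f≗0 =
  cong₂ _+_ (sumTo-zero n (λ k k≤n → f≗0 k (ℕ.m≤n⇒m≤1+n k≤n))) (f≗0 (suc n) ℕ.≤-refl)

sumTo-distrib-+ : ∀ n (f g : ℕ → ℤ) → sumTo n (λ k → f k + g k) ≡ sumTo n f + sumTo n g
sumTo-distrib-+ zero    f g = refl
sumTo-distrib-+ (suc n) f g =
  trans (cong (_+ (f (suc n) + g (suc n))) (sumTo-distrib-+ n f g))
        (interchange (sumTo n f) (sumTo n g) (f (suc n)) (g (suc n)))
  where
  interchange : ∀ a b c d → (a + b) + (c + d) ≡ (a + c) + (b + d)
  interchange = solve-∀

sumTo-neg : ∀ n (f : ℕ → ℤ) → sumTo n (λ k → - f k) ≡ - sumTo n f
sumTo-neg zero    f = refl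
sumTo-neg (suc n) f =
  trans (cong (_+ - f (suc n)) (sumTo-neg n f)) (sym (ℤ.neg-distrib-+ (sumTo n f) (f (suc n))))

*-distribˡ-sumTo : ∀ n c (f : ℕ → ℤ) → c * sumTo n f ≡ sumTo n (λ k → c * f k)
*-distribˡ-sumTo zero    c f = refl
*-distribˡ-sumTo (suc n) c f =
  trans (ℤ.*-distribˡ-+ c (sumTo n f) (f (suc n))) (cong (_+ c * f (suc n)) (*-distribˡ-sumTo n c f))

sumTo-head : ∀ n (f : ℕ → ℤ) → sumTo (suc n) f ≡ f 0 + sumTo n (f ∘ suc)
sumTo-head zero    f = refl
sumTo-head (suc n) f =
  trans (cong (_+ f (suc (suc n))) (sumTo-head n f)) (ℤ.+-assoc (f 0) _ _)

sumTo-telescope : ∀ n (h : ℕ → ℤ) → sumTo n (λ k → h (suc k) - h k) ≡ h (suc n) - h 0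
sumTo-telescope zero    h = refl
sumTo-telescope (suc n) h =
  trans (cong (_+ (h (suc (suc n)) - h (suc n))) (sumTo-telescope n h))
        (collapse (h 0) (h (suc n)) (h (suc (suc n))))
  where
  collapse : ∀ a b c → (b - a) + (c - b) ≡ c - a
  collapse = solve-∀

⊙-congˡ : ∀ {F F′} G n → (∀ j → j ≤ n → F j ≡ F′ j) → (F ⊙ G) n ≡ (F′ ⊙ G) n
⊙-congˡ G n F≗F′ = sumTo-cong n λ k k≤n → cong (λ x → + (n C k) * (x * G (n ∸ k))) (F≗F′ k k≤n)

⊙-congʳ : ∀ F {G G′} n → (∀ j → j ≤ n → G j ≡ G′ j) → (F ⊙ G) n ≡ (F ⊙ G′) n
⊙-congʳ F n G≗G′ = sumTo-cong n λ k _ → cong (λ x → + (n C k) * (F k * x)) (G≗G′ (n ∸ k) (ℕ.m∸n≤m n k))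

⊙-distribˡ-⊕ : ∀ F G H n → (F ⊙ (G ⊕ H)) n ≡ (F ⊙ G) n + (F ⊙ H) n
⊙-distribˡ-⊕ F G H n =
  trans (sumTo-cong n λ k _ → distrib (+ (n C k)) (F k) (G (n ∸ k)) (H (n ∸ k))) (sumTo-distrib-+ n _ _)
  where
  distrib : ∀ c f g h → c * (f * (g + h)) ≡ c * (f * g) + c * (f * h)
  distrib = solve-∀

⊙-scaleʳ : ∀ F G c n → (F ⊙ (λ j → c * G j)) n ≡ c * (F ⊙ G) n
⊙-scaleʳ F G c n =
  trans (sumTo-cong n λ k _ → commute (+ (n C k)) (F k) (G (n ∸ k)) c) (sym (*-distribˡ-sumTo n c _))
  where
  commute : ∀ b f g c → b * (f * (c * g)) ≡ c * (b * (f * g))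
  commute = solve-∀

⊙-negˡ : ∀ F G n → ((λ k → - F k) ⊙ G) n ≡ - (F ⊙ G) n
⊙-negˡ F G n = trans (sumTo-cong n λ k _ → pull-out (+ (n C k)) (F k) (G (n ∸ k))) (sumTo-neg n _)
  where
  pull-out : ∀ b f g → b * (- f * g) ≡ - (b * (f * g))
  pull-out = solve-∀

⊙-zeroʳ : ∀ F n → (F ⊙ (λ _ → + 0)) n ≡ + 0
⊙-zeroʳ F n = sumTo-zero n λ k _ → annihilate (+ (n C k)) (F k)
  where
  annihilate : ∀ b f → b * (f * + 0) ≡ + 0
  annihilate = solve-∀

⊙-distrib-∑ : ∀ {M} F (G : Fin M → VSpecies) n → ∑[ i < M ] (F ⊙ G i) n ≡ (F ⊙ (λ j → ∑[ i < M ] G i j)) n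
⊙-distrib-∑ {zero}  F G n = sym (⊙-zeroʳ F n)
⊙-distrib-∑ {suc M} F G n = trans
  (cong (_+_ ((F ⊙ G Fin.zero) n)) (⊙-distrib-∑ F (G ∘ Fin.suc) n))
  (sym (⊙-distribˡ-⊕ F (G Fin.zero) (λ j → ∑[ i < M ] G (Fin.suc i) j) n))

D-⊙ : ∀ F G n → D (F ⊙ G) n ≡ (D F ⊙ G) n + (F ⊙ D G) n
D-⊙ F G n = begin
  (F ⊙ G) (suc n)                                      ≡⟨ sumTo-head n _ ⟩
  t 0 + sumTo n (λ k → + (suc n C suc k) * u k)        ≡⟨ cong (_+_ (t 0)) pascal ⟩
  t 0 + ((D F ⊙ G) n + sumTo n (t ∘ suc))              ≡⟨ swap (t 0) ((D F ⊙ G) n) _ ⟩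
  (D F ⊙ G) n + (t 0 + sumTo n (t ∘ suc))              ≡⟨ cong (_+_ ((D F ⊙ G) n)) (sym (sumTo-head n t)) ⟩
  (D F ⊙ G) n + (sumTo n t + t (suc n))                ≡⟨ cong (λ x → (D F ⊙ G) n + (sumTo n t + x)) last-vanishes ⟩
  (D F ⊙ G) n + (sumTo n t + + 0)                      ≡⟨ cong (_+_ ((D F ⊙ G) n)) (trans (ℤ.+-identityʳ _) reindex) ⟩
  (D F ⊙ G) n + (F ⊙ D G) n                            ∎
  where
  u : ℕ → ℤ
  u k = F (suc k) * G (n ∸ k)
  t : ℕ → ℤ
  t k = + (n C k) * (F k * G (suc n ∸ k))
  pascal : sumTo n (λ k → + (suc n C suc k) * u k) ≡ (D F ⊙ G) n + sumTo n (t ∘ suc)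
  pascal = trans (sumTo-cong n λ k _ → begin
      + (suc n C suc k) * u k                 ≡⟨ cong (λ c → + c * u k) (sym (nCk+nC[k+1]≡[n+1]C[k+1] n k)) ⟩
      + (n C k ℕ.+ n C suc k) * u k           ≡⟨ cong (_* u k) (ℤ.pos-+ (n C k) (n C suc k)) ⟩
      (+ (n C k) + + (n C suc k)) * u k       ≡⟨ ℤ.*-distribʳ-+ (u k) (+ (n C k)) (+ (n C suc k)) ⟩
      + (n C k) * u k + + (n C suc k) * u k   ∎)
    (sumTo-distrib-+ n _ _)
  swap : ∀ a b c → a + (b + c) ≡ b + (a + c)
  swap = solve-∀
  last-vanishes : t (suc n) ≡ + 0
  last-vanishes = trans (cong (λ c → + c * (F (suc n) * G (n ∸ n))) (k>n⇒nCk≡0 (ℕ.n<1+n n)))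
                        (ℤ.*-zeroˡ (F (suc n) * G (n ∸ n)))
  reindex : sumTo n t ≡ (F ⊙ D G) n
  reindex = sumTo-cong n λ k k≤n → cong (λ m → + (n C k) * (F k * G m)) (ℕ.+-∸-assoc 1 k≤n)

E⊙-split : ∀ G n → (E ⊙ G) n ≡ G n + (E₊ ⊙ G) n
E⊙-split G zero    = split (G 0)
  where
  split : ∀ x → + 1 * (+ 1 * x) ≡ x + + 1 * (+ 0 * x)
  split = solve-∀
E⊙-split G (suc n) = begin
  (E ⊙ G) (suc n)                             ≡⟨ sumTo-head n _ ⟩
  + 1 * (+ 1 * G (suc n)) + rest              ≡⟨ split (G (suc n)) rest ⟩
  G (suc n) + (+ 1 * (+ 0 * G (suc n)) + rest) ≡⟨ cong (_+_ (G (suc n))) (sym (sumTo-head n _)) ⟩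
  G (suc n) + (E₊ ⊙ G) (suc n)                ∎
  where
  rest : ℤ
  rest = sumTo n (λ k → + (suc n C suc k) * (+ 1 * G (n ∸ k)))
  split : ∀ x s → + 1 * (+ 1 * x) + s ≡ x + (+ 1 * (+ 0 * x) + s)
  split = solve-∀

-- The inverse of E

E₊^-vanish : ∀ k n → n < k → (E₊ ^ k) n ≡ + 0
E₊^-vanish (suc k) n n<1+k = sumTo-zero n term
  where
  term : ∀ j → j ≤ n → + (n C j) * (E₊ j * (E₊ ^ k) (n ∸ j)) ≡ + 0
  term zero    _   = refl
  term (suc j) j<n =
    trans (cong (λ x → + (n C suc j) * (+ 1 * x)) (E₊^-vanish k (n ∸ suc j) n∸j<k))
          (ℤ.*-zeroʳ (+ (n C suc j)))
    where
    n∸j<k : n ∸ suc j < k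
    n∸j<k = ℕ.<-≤-trans (ℕ.∸-monoʳ-< (s≤s z≤n) j<n) (ℕ.s≤s⁻¹ n<1+k)

D-E₊^suc : ∀ k n → (E₊ ^ suc k) (suc n) ≡ + suc k * ((E₊ ^ k) n + (E₊ ^ suc k) n)
D-E₊^suc k n = begin
  (E₊ ^ suc k) (suc n)                        ≡⟨ D-⊙ E₊ (E₊ ^ k) n ⟩
  (E ⊙ E₊ ^ k) n + (E₊ ⊙ D (E₊ ^ k)) n        ≡⟨ cong₂ _+_ (E⊙-split (E₊ ^ k) n) (E₊⊙D-E₊^ k) ⟩
  (a + b) + + k * (a + b)                     ≡⟨ collect (+ k) a b ⟩
  + suc k * (a + b)                           ∎
  where
  a b : ℤ
  a = (E₊ ^ k) n
  b = (E₊ ^ suc k) n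
  collect : ∀ K a b → (a + b) + K * (a + b) ≡ (+ 1 + K) * (a + b)
  collect = solve-∀
  E₊⊙D-E₊^ : ∀ m → (E₊ ⊙ D (E₊ ^ m)) n ≡ + m * ((E₊ ^ m) n + (E₊ ^ suc m) n)
  E₊⊙D-E₊^ zero    = ⊙-zeroʳ E₊ n
  E₊⊙D-E₊^ (suc m) = begin
    (E₊ ⊙ D (E₊ ^ suc m)) n
      ≡⟨ ⊙-congʳ E₊ n (λ j _ → D-E₊^suc m j) ⟩
    (E₊ ⊙ (λ j → + suc m * (E₊ ^ m ⊕ E₊ ^ suc m) j)) n
      ≡⟨ ⊙-scaleʳ E₊ (E₊ ^ m ⊕ E₊ ^ suc m) (+ suc m) n ⟩
    + suc m * (E₊ ⊙ (E₊ ^ m ⊕ E₊ ^ suc m)) n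
      ≡⟨ cong (_*_ (+ suc m)) (⊙-distribˡ-⊕ E₊ (E₊ ^ m) (E₊ ^ suc m) n) ⟩
    + suc m * ((E₊ ^ suc m) n + (E₊ ^ suc (suc m)) n)
      ∎

-- Termwise, D-E₊^suc leaves -E⁻¹ plus a telescoping sum whose end terms vanish.
D-E⁻¹ : ∀ n → E⁻¹ (suc n) ≡ - E⁻¹ n
D-E⁻¹ n = begin
  E⁻¹ (suc n)
    ≡⟨ sumTo-head n _ ⟩
  + 0 + sumTo n (λ k → sign (suc k) * (E₊ ^ suc k) (suc n))
    ≡⟨ ℤ.+-identityˡ _ ⟩
  sumTo n (λ k → sign (suc k) * (E₊ ^ suc k) (suc n))
    ≡⟨ sumTo-cong n (λ k _ → term k) ⟩
  sumTo n (λ k → - (sign k * (E₊ ^ k) n) + (h (suc k) - h k))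
    ≡⟨ sumTo-distrib-+ n _ _ ⟩
  sumTo n (λ k → - (sign k * (E₊ ^ k) n)) + sumTo n (λ k → h (suc k) - h k)
    ≡⟨ cong₂ _+_ (sumTo-neg n _) (sumTo-telescope n h) ⟩
  - E⁻¹ n + (h (suc n) - + 0)
    ≡⟨ cong (λ x → - E⁻¹ n + (sign (suc n) * (+ suc n * x) - + 0)) (E₊^-vanish (suc n) n (ℕ.n<1+n n)) ⟩
  - E⁻¹ n + (sign (suc n) * (+ suc n * + 0) - + 0)
    ≡⟨ drop (- E⁻¹ n) (sign (suc n)) (+ suc n) ⟩
  - E⁻¹ n
    ∎
  where
  h : ℕ → ℤ
  h k = sign k * (+ k * (E₊ ^ k) n)
  expand : ∀ s K a b → - s * ((+ 1 + K) * (a + b)) ≡ - (s * a) + (- s * ((+ 1 + K) * b) - s * (K * a))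
  expand = solve-∀
  term : ∀ k → sign (suc k) * (E₊ ^ suc k) (suc n) ≡ - (sign k * (E₊ ^ k) n) + (h (suc k) - h k)
  term k = trans (cong (_*_ (sign (suc k))) (D-E₊^suc k n))
                 (expand (sign k) (+ k) ((E₊ ^ k) n) ((E₊ ^ suc k) n))
  drop : ∀ e s K → e + (s * (K * + 0) - + 0) ≡ e
  drop = solve-∀

E⁻¹-cancelˡ : ∀ G n → (E⁻¹ ⊙ (E ⊙ G)) n ≡ G n
E⁻¹-cancelˡ G zero    = unit (G 0)
  where
  unit : ∀ x → + 1 * (+ 1 * (+ 1 * (+ 1 * x))) ≡ x
  unit = solve-∀
E⁻¹-cancelˡ G (suc m) = begin
  (E⁻¹ ⊙ X) (suc m)                                    ≡⟨ D-⊙ E⁻¹ X m ⟩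
  (D E⁻¹ ⊙ X) m + (E⁻¹ ⊙ D X) m                        ≡⟨ cong₂ _+_ D-E⁻¹⊙X E⁻¹⊙D-X ⟩
  - (E⁻¹ ⊙ X) m + ((E⁻¹ ⊙ X) m + (E⁻¹ ⊙ (E ⊙ D G)) m)  ≡⟨ cancel ((E⁻¹ ⊙ X) m) _ ⟩
  (E⁻¹ ⊙ (E ⊙ D G)) m                                  ≡⟨ E⁻¹-cancelˡ (D G) m ⟩
  G (suc m)                                            ∎
  where
  X : VSpecies
  X = E ⊙ G
  D-E⁻¹⊙X : (D E⁻¹ ⊙ X) m ≡ - (E⁻¹ ⊙ X) m
  D-E⁻¹⊙X = trans (⊙-congˡ X m (λ j _ → D-E⁻¹ j)) (⊙-negˡ E⁻¹ X m)
  E⁻¹⊙D-X : (E⁻¹ ⊙ D X) m ≡ (E⁻¹ ⊙ X) m + (E⁻¹ ⊙ (E ⊙ D G)) m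
  E⁻¹⊙D-X = trans (⊙-congʳ E⁻¹ m (λ j _ → D-⊙ E G j)) (⊙-distribˡ-⊕ E⁻¹ X (E ⊙ D G) m)
  cancel : ∀ a b → - a + (a + b) ≡ b
  cancel = solve-∀

∫-E⁻¹-inversion : ∀ {C P : VSpecies} → P 0 ≡ + 0 → C ≈ 𝟙 ⊕ ∫ (E ⊙ D P) → P ≈ ∫ (E⁻¹ ⊙ D C)
∫-E⁻¹-inversion P0≡0 C≈ zero    = P0≡0
∫-E⁻¹-inversion {C} {P} P0≡0 C≈ (suc m) = sym (begin
  (E⁻¹ ⊙ D C) m          ≡⟨ ⊙-congʳ E⁻¹ {G′ = E ⊙ D P} m (λ j _ → trans (C≈ (suc j)) (ℤ.+-identityˡ _)) ⟩
  (E⁻¹ ⊙ (E ⊙ D P)) m    ≡⟨ E⁻¹-cancelˡ (D P) m ⟩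
  P (suc m)              ∎)

-- Stuttering

StutterInvariant : {A B : Set} → (List A → B) → Set
StutterInvariant f = ∀ u a r → f (u ++ a ∷ a ∷ r) ≡ f (u ++ a ∷ r)

foldr-stutter : {A B : Set} (g : A → B → B) (e : B) →
  (∀ x y → g x (g x y) ≡ g x y) → StutterInvariant (foldr g e)
foldr-stutter g e absorb []      a r = absorb a (foldr g e r)
foldr-stutter g e absorb (x ∷ u) a r = cong (g x) (foldr-stutter g e absorb u a r)

map-stutter : {A B C : Set} {f : List B → C} (h : A → B) → StutterInvariant f → StutterInvariant (f ∘ map h)
map-stutter {f = f} h f-inv u a r = begin
  f (map h (u ++ a ∷ a ∷ r))            ≡⟨ cong f (map-++ h u (a ∷ a ∷ r)) ⟩
  f (map h u ++ h a ∷ h a ∷ map h r)    ≡⟨ f-inv (map h u) (h a) (map h r) ⟩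
  f (map h u ++ h a ∷ map h r)          ≡⟨ cong f (map-++ h u (a ∷ r)) ⟨
  f (map h (u ++ a ∷ r))                ∎

all-stutter : {A : Set} (p : A → Bool) → StutterInvariant (all p)
all-stutter p = map-stutter {f = and} p (foldr-stutter _∧_ true λ { true _ → refl ; false _ → refl })

any-stutter : {A : Set} (p : A → Bool) → StutterInvariant (any p)
any-stutter p = map-stutter {f = or} p (foldr-stutter _∨_ false λ { true _ → refl ; false _ → refl })

maxL-stutter : StutterInvariant maxL
maxL-stutter = foldr-stutter _⊔_ 0 λ x y → trans (sym (ℕ.⊔-assoc x x y)) (cong (_⊔ y) (ℕ.⊔-idem x))

isCayley-stutter : StutterInvariant isCayley
isCayley-stutter u a r = cong₂ _∧_ (all-stutter (1 ℕ.≤ᵇ_) u a r) (begin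
  all (λ v → elemᵇ v w₂) (map suc (upTo (maxL w₂)))
    ≡⟨ cong (λ m → all (λ v → elemᵇ v w₂) (map suc (upTo m))) (maxL-stutter u a r) ⟩
  all (λ v → elemᵇ v w₂) (map suc (upTo (maxL w₁)))
    ≡⟨ cong and (map-cong (λ v → any-stutter (ℕ._≡ᵇ v) u a r) (map suc (upTo (maxL w₁)))) ⟩
  all (λ v → elemᵇ v w₁) (map suc (upTo (maxL w₁)))
    ∎)
  where
  w₁ w₂ : List ℕ
  w₁ = u ++ a ∷ r
  w₂ = u ++ a ∷ a ∷ r

∈-subseqs⁺ : ∀ {s w : List ℕ} → s ⊆ w → s ∈ subseqs w
∈-subseqs⁺ []                     = here refl
∈-subseqs⁺ (_ ∷ʳ τ)               = ∈-++⁺ˡ (∈-subseqs⁺ τ)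
∈-subseqs⁺ {w = x ∷ w} (refl ∷ τ) = ∈-++⁺ʳ (subseqs w) (∈-map⁺ (x ∷_) (∈-subseqs⁺ τ))

∈-subseqs⁻ : ∀ {s} w → s ∈ subseqs w → s ⊆ w
∈-subseqs⁻ []      (here refl) = []
∈-subseqs⁻ (x ∷ w) s∈ with ∈-++⁻ (subseqs w) s∈
... | inj₁ s∈′ = x ∷ʳ ∈-subseqs⁻ w s∈′
... | inj₂ s∈′ with ∈-map⁻ (x ∷_) s∈′
...   | _ , s′∈ , refl = refl ∷ ∈-subseqs⁻ w s′∈

⊆-unstutter : ∀ {s : List ℕ} u a r → s ⊆ u ++ a ∷ a ∷ r →
  s ⊆ u ++ a ∷ r ⊎ ∃₂ λ s₁ s₂ → s ≡ s₁ ++ a ∷ a ∷ s₂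
⊆-unstutter []      a r (_ ∷ʳ τ)          = inj₁ τ
⊆-unstutter []      a r (refl ∷ _ ∷ʳ τ)   = inj₁ (refl ∷ τ)
⊆-unstutter []      a r (refl ∷ refl ∷ τ) = inj₂ ([] , _ , refl)
⊆-unstutter (x ∷ u) a r (_ ∷ʳ τ)          = Sum.map₁ (x ∷ʳ_) (⊆-unstutter u a r τ)
⊆-unstutter (x ∷ u) a r (refl ∷ τ)        =
  Sum.map (refl ∷_) (λ (s₁ , s₂ , eq) → x ∷ s₁ , s₂ , cong (x ∷_) eq) (⊆-unstutter u a r τ)

⊆-stutter : ∀ {s : List ℕ} u a r → s ⊆ u ++ a ∷ r → s ⊆ u ++ a ∷ a ∷ r
⊆-stutter u a r τ = ⊆-trans τ (++⁺ (⊆-refl {x = u}) (a ∷ʳ ⊆-refl))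

≡ᵇ-refl : ∀ n → (n ≡ᵇ n) ≡ true
≡ᵇ-refl n = Equivalence.to T-≡ (ℕ.≡⇒≡ᵇ n n refl)

noAdjEq-stutter : ∀ p₁ c p₂ → noAdjEq (p₁ ++ c ∷ c ∷ p₂) ≡ false
noAdjEq-stutter []           c p₂ rewrite ≡ᵇ-refl c = refl
noAdjEq-stutter (x ∷ [])     c p₂ =
  trans (cong (not (x ≡ᵇ c) ∧_) (noAdjEq-stutter [] c p₂)) (∧-zeroʳ _)
noAdjEq-stutter (x ∷ y ∷ p₁) c p₂ =
  trans (cong (not (x ≡ᵇ y) ∧_) (noAdjEq-stutter (y ∷ p₁) c p₂)) (∧-zeroʳ _)

orderIso-length : ∀ u v → T (orderIso u v) → length u ≡ length v
orderIso-length _ _ iso = ℕ.≡ᵇ⇒≡ _ _ (proj₁ (Equivalence.to T-∧ iso))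

orderIso-≡ᵇ : ∀ {u v a b c d} → T (orderIso u v) → (a , b) ∈ zip u v → (c , d) ∈ zip u v →
  T ((a ≡ᵇ c) == (b ≡ᵇ d))
orderIso-≡ᵇ {u} {v} iso ab∈ cd∈ = proj₂ (Equivalence.to T-∧
  (All.lookup (all⁺ _ _ (All.lookup (all⁺ _ (zip u v) (proj₂ (Equivalence.to T-∧ iso))) ab∈)) cd∈))

∈-zip-++ : ∀ {z} (s p : List ℕ) {xs ys} → length s ≡ length p → z ∈ zip xs ys → z ∈ zip (s ++ xs) (p ++ ys)
∈-zip-++ []      []      _  z∈ = z∈
∈-zip-++ (_ ∷ s) (_ ∷ p) eq z∈ = there (∈-zip-++ s p (ℕ.suc-injective eq) z∈)

align : ∀ (s₁ : List ℕ) b b′ s₂ p → length (s₁ ++ b ∷ b′ ∷ s₂) ≡ length p →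
  ∃₂ λ (p₁ p₂ : List ℕ) → ∃₂ λ c c′ → p ≡ p₁ ++ c ∷ c′ ∷ p₂ × length s₁ ≡ length p₁
align []       b b′ s₂ (c ∷ c′ ∷ p₂) _  = [] , p₂ , c , c′ , refl , refl
align (_ ∷ s₁) b b′ s₂ (y ∷ p)       eq with align s₁ b b′ s₂ p (ℕ.suc-injective eq)
... | p₁ , p₂ , c , c′ , refl , |s₁|≡|p₁| = y ∷ p₁ , p₂ , c , c′ , refl , cong suc |s₁|≡|p₁|

orderIso-stutter : ∀ s₁ b s₂ p → T (orderIso (s₁ ++ b ∷ b ∷ s₂) p) →
  ∃₂ λ (p₁ p₂ : List ℕ) → ∃ λ c → p ≡ p₁ ++ c ∷ c ∷ p₂
orderIso-stutter s₁ b s₂ p iso with align s₁ b b s₂ p (orderIso-length (s₁ ++ b ∷ b ∷ s₂) p iso)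
... | p₁ , p₂ , c , c′ , refl , |s₁|≡|p₁| = p₁ , p₂ , c , cong (λ d → p₁ ++ c ∷ d ∷ p₂) (sym (ℕ.≡ᵇ⇒≡ c c′ c≡ᵇc′))
  where
  c≡ᵇc′ : T (c ≡ᵇ c′)
  c≡ᵇc′ with orderIso-≡ᵇ iso (∈-zip-++ s₁ p₁ |s₁|≡|p₁| (here refl)) (∈-zip-++ s₁ p₁ |s₁|≡|p₁| (there (here refl)))
  ... | b≡ᵇb==c≡ᵇc′ rewrite ≡ᵇ-refl b = b≡ᵇb==c≡ᵇc′

contains⁺ : ∀ {s w p} → s ⊆ w → T (orderIso s p) → T (contains w p)
contains⁺ τ iso = any⁺ _ (lose (∈-subseqs⁺ τ) iso)

contains⁻ : ∀ w p → T (contains w p) → ∃[ s ] s ⊆ w × T (orderIso s p)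
contains⁻ w p h with find (any⁻ _ (subseqs w) h)
... | s , s∈ , iso = s , ∈-subseqs⁻ w s∈ , iso

contains-stutter : ∀ p → noAdjEq p ≡ true → StutterInvariant (λ w → contains w p)
contains-stutter p p-free u a r = ⇔→≡ (mk⇔ (viaT unstutter) (viaT stutter))
  where
  viaT : ∀ {x y} → (T x → T y) → x ≡ true → y ≡ true
  viaT f = Equivalence.to T-≡ ∘ f ∘ Equivalence.from T-≡
  unstutter : T (contains (u ++ a ∷ a ∷ r) p) → T (contains (u ++ a ∷ r) p)
  unstutter h with contains⁻ _ p h
  ... | s , τ , iso with ⊆-unstutter u a r τ
  ...   | inj₁ τ′              = contains⁺ τ′ iso
  ...   | inj₂ (s₁ , s₂ , refl) with orderIso-stutter s₁ a s₂ p iso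
  ...     | p₁ , p₂ , c , refl with trans (sym (noAdjEq-stutter p₁ c p₂)) p-free
  ...       | ()
  stutter : T (contains (u ++ a ∷ r) p) → T (contains (u ++ a ∷ a ∷ r) p)
  stutter h with contains⁻ _ p h
  ... | s , τ , iso = contains⁺ (⊆-stutter u a r τ) iso

-- Counting words

letter : ∀ {M} → Fin M → ℕ
letter i = suc (toℕ i)

count : ℕ → ℕ → (List ℕ → Bool) → ℤ
count M zero    P = if P [] then + 1 else + 0
count M (suc n) P = ∑[ i < M ] count M n (λ w → P (letter i ∷ w))

countB-++ : {A : Set} (P : A → Bool) (xs ys : List A) → countB P (xs ++ ys) ≡ countB P xs ℕ.+ countB P ys
countB-++ P []       ys = refl
countB-++ P (x ∷ xs) ys with P x
... | true  = cong suc (countB-++ P xs ys)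
... | false = countB-++ P xs ys

countB-map : {A B : Set} (P : B → Bool) (g : A → B) (xs : List A) → countB P (map g xs) ≡ countB (P ∘ g) xs
countB-map P g = foldr-map (λ x k → if P x then suc k else k) g 0

countB-concatMap : (P : List ℕ → Bool) (F : ℕ → List (List ℕ)) (h : ℕ → ℕ) (M : ℕ) →
  + countB P (concatMap F (map suc (applyUpTo h M))) ≡ ∑[ i < M ] (+ countB P (F (suc (h (toℕ i)))))
countB-concatMap P F h zero    = refl
countB-concatMap P F h (suc M) = begin
  + countB P (first ++ rest)                   ≡⟨ cong +_ (countB-++ P first rest) ⟩
  + (countB P first ℕ.+ countB P rest)         ≡⟨ ℤ.pos-+ (countB P first) (countB P rest) ⟩
  + countB P first + + countB P rest           ≡⟨ cong (_+_ (+ countB P first)) (countB-concatMap P F (h ∘ suc) M) ⟩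
  ∑[ i < suc M ] (+ countB P (F (suc (h (toℕ i)))))  ∎
  where
  first rest : List (List ℕ)
  first = F (suc (h 0))
  rest  = concatMap F (map suc (applyUpTo (h ∘ suc) M))

countB-allWords : ∀ M n P → + countB P (allWords M n) ≡ count M n P
countB-allWords M zero    P with P []
... | true  = refl
... | false = refl
countB-allWords M (suc n) P = trans (countB-concatMap P (λ a → map (a ∷_) (allWords M n)) (λ a → a) M)
  (sum-cong-≗ {M} λ i → trans (cong +_ (countB-map P (letter i ∷_) (allWords M n)))
                          (countB-allWords M n (λ w → P (letter i ∷ w))))

count-cong : ∀ M n {P Q : List ℕ → Bool} → (∀ w → length w ≡ n → P w ≡ Q w) → count M n P ≡ count M n Q
count-cong M zero    P≗Q = cong (if_then + 1 else + 0) (P≗Q [] refl)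
count-cong M (suc n) P≗Q = sum-cong-≗ {M} λ i → count-cong M n λ w |w| → P≗Q (letter i ∷ w) (cong suc |w|)

count-none : ∀ M n (P : List ℕ → Bool) → (∀ w → length w ≡ n → P w ≡ false) → count M n P ≡ + 0
count-none M zero    P none rewrite none [] refl = refl
count-none M (suc n) P none = trans
  (sum-cong-≗ {M} λ i → count-none M n _ λ w |w| → none (letter i ∷ w) (cong suc |w|))
  (sum-replicate-zero M)

count-split : ∀ M n (P Q : List ℕ → Bool) →
  count M n P ≡ count M n (λ w → P w ∧ Q w) + count M n (λ w → P w ∧ not (Q w))
count-split M zero P Q with P [] | Q []
... | true  | true  = refl
... | true  | false = refl
... | false | _     = refl
count-split M (suc n) P Q = trans
  (sum-cong-≗ {M} λ i → count-split M n (λ w → P (letter i ∷ w)) (λ w → Q (letter i ∷ w)))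
  (∑-distrib-+ {M} _ _)

LettersAtMost : ℕ → ℕ → (List ℕ → Bool) → Set
LettersAtMost M n P = ∀ w → length w ≡ n → P w ≡ true → All (_≤ M) w

count-extend : ∀ M n (P : List ℕ → Bool) → LettersAtMost M n P → count (suc M) n P ≡ count M n P
count-extend M zero    P letters≤M = refl
count-extend M (suc n) P letters≤M = begin
  ∑[ i < suc M ] f i                        ≡⟨ sum-init-last f ⟩
  ∑[ i < M ] f (inject₁ i) + f (fromℕ M)    ≡⟨ cong₂ _+_ (sum-cong-≗ {M} old-letters) new-letter ⟩
  ∑[ i < M ] count M n (λ w → P (letter i ∷ w)) + + 0   ≡⟨ ℤ.+-identityʳ _ ⟩
  count M (suc n) P                         ∎
  where
  f : Fin (suc M) → ℤ
  f i = count (suc M) n (λ w → P (letter i ∷ w))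
  old-letters : ∀ i → f (inject₁ i) ≡ count M n (λ w → P (letter i ∷ w))
  old-letters i rewrite Fin.toℕ-inject₁ i =
    count-extend M n _ λ { w |w| Pw → All.tail (letters≤M (_ ∷ w) (cong suc |w|) Pw) }
  new-letter : f (fromℕ M) ≡ + 0
  new-letter rewrite Fin.toℕ-fromℕ M = count-none (suc M) n _ excluded
    where
    excluded : ∀ w → length w ≡ n → P (suc M ∷ w) ≡ false
    excluded w |w| with P (suc M ∷ w) in Pw
    ... | false = refl
    ... | true  = contradiction (All.head (letters≤M (suc M ∷ w) (cong suc |w|) Pw)) (ℕ.n≮n M)

count-widen : ∀ {M M′} n P → M ≤ M′ → LettersAtMost M n P → count M′ n P ≡ count M n P
count-widen {M} n P M≤M′ letters≤M = widen (ℕ.≤⇒≤′ M≤M′)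
  where
  widen : ∀ {M′} → M ≤′ M′ → count M′ n P ≡ count M n P
  widen ≤′-refl            = refl
  widen (≤′-step M≤′M′) = trans
    (count-extend _ n P λ w |w| Pw → All.map (λ x≤M → ℕ.≤-trans x≤M (ℕ.≤′⇒≤ M≤′M′)) (letters≤M w |w| Pw))
    (widen M≤′M′)

∑-indicator : ∀ {M} (g : Fin M → Bool → ℤ) (i : Fin M) → (∀ j → g j false ≡ + 0) →
  ∑[ j < M ] g j (toℕ i ≡ᵇ toℕ j) ≡ g i true
∑-indicator {suc M} g Fin.zero g-false = begin
  g Fin.zero true + ∑[ j < M ] g (Fin.suc j) false
    ≡⟨ cong (_+_ (g Fin.zero true)) (trans (sum-cong-≗ {M} (g-false ∘ Fin.suc)) (sum-replicate-zero M)) ⟩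
  g Fin.zero true + + 0
    ≡⟨ ℤ.+-identityʳ _ ⟩
  g Fin.zero true
    ∎
∑-indicator g (Fin.suc i) g-false =
  trans (cong₂ _+_ (g-false Fin.zero) (∑-indicator (g ∘ Fin.suc) i (g-false ∘ Fin.suc))) (ℤ.+-identityˡ _)

startsWith : ℕ → List ℕ → Bool
startsWith a []      = false
startsWith a (b ∷ _) = a ≡ᵇ b

startsWith-stutter : ∀ a → StutterInvariant (startsWith a)
startsWith-stutter a []      b r = refl
startsWith-stutter a (x ∷ u) b r = refl

distinctResidual : (List ℕ → Bool) → ℕ → List ℕ → Bool
distinctResidual P a v = P (a ∷ v) ∧ not (startsWith a v)

distinctResidual-stutter : ∀ P a → StutterInvariant P → StutterInvariant (distinctResidual P a)
distinctResidual-stutter P a P-inv u b r =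
  cong₂ (λ x y → x ∧ not y) (P-inv (a ∷ u) b r) (startsWith-stutter a u b r)

stutterFree : ℕ → (List ℕ → Bool) → VSpecies
stutterFree M P n = count M n (λ w → P w ∧ noAdjEq w)

-- Split the words by whether their second letter repeats the first; the repeating ones lose that letter.
count-stutter-recurrence : ∀ M n P → StutterInvariant P →
  count M (suc (suc n)) P ≡ count M (suc n) P + ∑[ i < M ] count M (suc n) (distinctResidual P (letter i))
count-stutter-recurrence M n P P-inv = begin
  ∑[ i < M ] count M (suc n) (λ v → P (letter i ∷ v))
    ≡⟨ sum-cong-≗ {M} (λ i → count-split M (suc n) (λ v → P (letter i ∷ v)) (startsWith (letter i))) ⟩
  ∑[ i < M ] (count M (suc n) (repeating i) + count M (suc n) (distinctResidual P (letter i)))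
    ≡⟨ ∑-distrib-+ {M} _ _ ⟩
  ∑[ i < M ] count M (suc n) (repeating i) + ∑[ i < M ] count M (suc n) (distinctResidual P (letter i))
    ≡⟨ cong (_+ ∑[ i < M ] count M (suc n) (distinctResidual P (letter i))) (sum-cong-≗ {M} collapse) ⟩
  count M (suc n) P + ∑[ i < M ] count M (suc n) (distinctResidual P (letter i)) ∎
  where
  repeating : Fin M → List ℕ → Bool
  repeating i v = P (letter i ∷ v) ∧ startsWith (letter i) v
  collapse : ∀ i → count M (suc n) (repeating i) ≡ count M n (λ r → P (letter i ∷ r))
  collapse i = begin
    ∑[ j < M ] count M n (λ r → P (letter i ∷ letter j ∷ r) ∧ (toℕ i ≡ᵇ toℕ j))
      ≡⟨ ∑-indicator (λ j b → count M n (λ r → P (letter i ∷ letter j ∷ r) ∧ b)) i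
                     (λ j → count-none M n _ λ r _ → ∧-zeroʳ _) ⟩
    count M n (λ r → P (letter i ∷ letter i ∷ r) ∧ true)
      ≡⟨ count-cong M n (λ r _ → trans (∧-identityʳ _) (P-inv [] (letter i) r)) ⟩
    count M n (λ r → P (letter i ∷ r)) ∎

∑-stutterFree-distinctResidual : ∀ M P n →
  ∑[ i < M ] stutterFree M (distinctResidual P (letter i)) (suc n) ≡ stutterFree M P (suc (suc n))
∑-stutterFree-distinctResidual M P n = sum-cong-≗ {M} λ i → count-cong M (suc n)
  {λ v → distinctResidual P (letter i) v ∧ noAdjEq v} {λ v → P (letter i ∷ v) ∧ noAdjEq (letter i ∷ v)} λ where
    (b ∷ r) _ → ∧-assoc (P (letter i ∷ b ∷ r)) (not (letter i ≡ᵇ b)) (noAdjEq (b ∷ r))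

count-stutterInvariant : ∀ M P → StutterInvariant P → ∀ n → count M (suc n) P ≡ (E ⊙ D (stutterFree M P)) n
count-stutterInvariant M P P-inv zero = trans
  (count-cong M 1 {P} {λ w → P w ∧ noAdjEq w} λ { (x ∷ []) _ → sym (∧-identityʳ (P (x ∷ []))) })
  (unit (stutterFree M P 1))
  where
  unit : ∀ x → x ≡ + 1 * (+ 1 * x)
  unit = solve-∀
count-stutterInvariant M P P-inv (suc n) = begin
  count M (suc (suc n)) P
    ≡⟨ count-stutter-recurrence M n P P-inv ⟩
  count M (suc n) P + ∑[ i < M ] count M (suc n) (distinctResidual P (letter i))
    ≡⟨ cong₂ _+_ (count-stutterInvariant M P P-inv n) (sum-cong-≗ {M} λ i →
         count-stutterInvariant M (distinctResidual P (letter i)) (distinctResidual-stutter P (letter i) P-inv) n) ⟩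
  (E ⊙ D F) n + ∑[ i < M ] (E ⊙ D (stutterFree M (distinctResidual P (letter i)))) n
    ≡⟨ cong (_+_ ((E ⊙ D F) n)) (⊙-distrib-∑ {M} E (λ i → D (stutterFree M (distinctResidual P (letter i)))) n) ⟩
  (E ⊙ D F) n + (E ⊙ (λ j → ∑[ i < M ] stutterFree M (distinctResidual P (letter i)) (suc j))) n
    ≡⟨ cong (_+_ ((E ⊙ D F) n)) (⊙-congʳ E n λ j _ → ∑-stutterFree-distinctResidual M P j) ⟩
  (E ⊙ D F) n + (E ⊙ D (D F)) n
    ≡⟨ D-⊙ E (D F) n ⟨
  (E ⊙ D F) (suc n) ∎
  where
  F : VSpecies
  F = stutterFree M P

-- Cayley permutations avoiding a primitive pattern

maxL-upper : ∀ w → All (_≤ maxL w) w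
maxL-upper []      = []
maxL-upper (x ∷ w) =
  ℕ.m≤m⊔n x (maxL w) ∷ All.map (λ y≤max → ℕ.≤-trans y≤max (ℕ.m≤n⊔m x (maxL w))) (maxL-upper w)

-- The letters 1, …, max w occur at pairwise distinct positions of w.
maxL≤length : ∀ w → isCayley w ≡ true → maxL w ≤ length w
maxL≤length w cayley = Fin.injective⇒≤ position-injective
  where
  surjective : T (all (λ v → elemᵇ v w) (map suc (upTo (maxL w))))
  surjective = proj₂ (Equivalence.to T-∧ (Equivalence.from T-≡ cayley))
  occurs : (i : Fin (maxL w)) → letter i ∈ w
  occurs i = Any.map (λ x≡ᵇi → sym (ℕ.≡ᵇ⇒≡ _ _ x≡ᵇi))
    (any⁻ _ w (All.lookup (all⁺ _ _ surjective) (∈-map⁺ suc (∈-upTo⁺ (Fin.toℕ<n i)))))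
  position : Fin (maxL w) → Fin (length w)
  position i = Any.index (occurs i)
  position-injective : ∀ {i j} → position i ≡ position j → i ≡ j
  position-injective {i} {j} same = Fin.toℕ-injective (ℕ.suc-injective (begin
    letter i                ≡⟨ lookup-index (occurs i) ⟩
    lookup w (position i)   ≡⟨ cong (lookup w) same ⟩
    lookup w (position j)   ≡⟨ lookup-index (occurs j) ⟨
    letter j                ∎))

Cayley-letters≤length : ∀ w → isCayley w ≡ true → All (_≤ length w) w
Cayley-letters≤length w cayley = All.map (λ x≤max → ℕ.≤-trans x≤max (maxL≤length w cayley)) (maxL-upper w)

cayleyAvoiding : List ℕ → List ℕ → Bool
cayleyAvoiding p w = isCayley w ∧ not (contains w p)

cayleyAvoiding-stutter : ∀ p → noAdjEq p ≡ true → StutterInvariant (cayleyAvoiding p)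
cayleyAvoiding-stutter p p-free u a r =
  cong₂ (λ x y → x ∧ not y) (isCayley-stutter u a r) (contains-stutter p p-free u a r)

D-stutterFree-cayleyAvoiding : ∀ p m j → j ≤ m →
  D (stutterFree (suc m) (cayleyAvoiding p)) j ≡ D (Prim p) j
D-stutterFree-cayleyAvoiding p m j j≤m = begin
  count (suc m) (suc j) (λ w → cayleyAvoiding p w ∧ noAdjEq w)      ≡⟨ count-widen (suc j) _ (s≤s j≤m) letters≤ ⟩
  count (suc j) (suc j) (λ w → cayleyAvoiding p w ∧ noAdjEq w)      ≡⟨ count-cong (suc j) (suc j) reassociate ⟩
  count (suc j) (suc j) (λ w → isPrimitive w ∧ not (contains w p))  ≡⟨ countB-allWords (suc j) (suc j) _ ⟨
  Prim p (suc j)                                                    ∎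
  where
  letters≤ : LettersAtMost (suc j) (suc j) (λ w → cayleyAvoiding p w ∧ noAdjEq w)
  letters≤ w |w| avoiding = subst (λ n → All (_≤ n) w) |w|
    (Cayley-letters≤length w (∧-conicalˡ _ _ (∧-conicalˡ _ _ avoiding)))
  reassociate : ∀ w → length w ≡ suc j →
    (cayleyAvoiding p w ∧ noAdjEq w) ≡ (isPrimitive w ∧ not (contains w p))
  reassociate w@(_ ∷ _) _ = begin
    (isCayley w ∧ not (contains w p)) ∧ noAdjEq w   ≡⟨ ∧-assoc (isCayley w) _ _ ⟩
    isCayley w ∧ (not (contains w p) ∧ noAdjEq w)   ≡⟨ cong (isCayley w ∧_) (∧-comm (not (contains w p)) _) ⟩
    isCayley w ∧ (noAdjEq w ∧ not (contains w p))   ≡⟨ ∧-assoc (isCayley w) _ _ ⟨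
    (isCayley w ∧ noAdjEq w) ∧ not (contains w p)   ∎

Cay≈𝟙⊕∫E⊙DPrim : ∀ p → isPrimitive p ≡ true → Cay p ≈ 𝟙 ⊕ ∫ (E ⊙ D (Prim p))
Cay≈𝟙⊕∫E⊙DPrim []         ()
Cay≈𝟙⊕∫E⊙DPrim p@(_ ∷ _) p-primitive zero    = refl
Cay≈𝟙⊕∫E⊙DPrim p@(_ ∷ _) p-primitive (suc m) = begin
  Cay p (suc m)                                       ≡⟨ countB-allWords (suc m) (suc m) _ ⟩
  count (suc m) (suc m) avoiding                      ≡⟨ count-stutterInvariant (suc m) avoiding avoiding-stutter m ⟩
  (E ⊙ D (stutterFree (suc m) avoiding)) m            ≡⟨ ⊙-congʳ E m (D-stutterFree-cayleyAvoiding p m) ⟩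
  (E ⊙ D (Prim p)) m                                  ≡⟨ ℤ.+-identityˡ _ ⟨
  (𝟙 ⊕ ∫ (E ⊙ D (Prim p))) (suc m)                    ∎
  where
  avoiding : List ℕ → Bool
  avoiding = cayleyAvoiding p
  avoiding-stutter : StutterInvariant avoiding
  avoiding-stutter = cayleyAvoiding-stutter p (∧-conicalʳ (isCayley p) _ p-primitive)

proposition7p3 : (p : List ℕ) → isPrimitive p ≡ true →
    (Cay p ≈ 𝟙 ⊕ ∫ (E ⊙ D (Prim p))) × (Prim p ≈ ∫ (E⁻¹ ⊙ D (Cay p)))
proposition7p3 p p-primitive = Cay≈ , ∫-E⁻¹-inversion refl Cay≈
  where
  Cay≈ : Cay p ≈ 𝟙 ⊕ ∫ (E ⊙ D (Prim p))
  Cay≈ = Cay≈𝟙⊕∫E⊙DPrim p p-primitive
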